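{- For $n\geq1$, the map $\mathcal{L}(\varepsilon Z_n)\to U_n$ given by $\pi\mapsto u=\pi^{ -1}\varepsilon$ is a bijection, and for every $\pi\in\mathcal{L}(\varepsilon Z_n)$ we have $\mathrm{Des}(\pi)=\mathrm{Ret}_1(u)$.
   Context: Permutations compose as functions: $(\pi^{ -1}\varepsilon)(i)=\pi^{ -1}(\varepsilon(i))$. The zig-zag poset $Z_n$ on $[n]$ is generated by $j<j+1$ for odd $j\in[n-1]$ and $j>j+1$ for even $j$; $\varepsilon\in S_n$ is the involution swapping $2i$ and $2i+1$ for each $i\ge1$ with $2i+1\leq n$; $\varepsilon Z_n$ is the poset with $\varepsilon(i)<\varepsilon(j)$ iff $i<_{Z_n}j$. $\mathcal{L}(P)$ is the set of $\pi\in S_n$ with $\pi^{ -1}(i)<\pi^{ -1}(j)$ whenever $i<_Pj$. $U_n$ is the set of $u\in S_n$ with $u(1)<u(2)>u(3)<\cdots$. $\mathrm{Des}(\pi)=\{i\in[n-1]:\pi(i)>\pi(i+1)\}$ and $\mathrm{Ret}_1(u)=\{i\in[n-1]:u^{ -1}(i)>u^{ -1}(i+1)+1\}$. -}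

module Defs where

open import Data.Nat using (ℕ; zero; suc; _+_; _∸_; _≤_; _<_; _%_; _<?_; _≤?_)
open import Data.Fin using (Fin; toℕ; fromℕ<)
open import Data.Fin.Permutation using (Permutation′; _⟨$⟩ʳ_; _⟨$⟩ˡ_)
open import Data.Product using (Σ; _×_; ∃)
open import Data.Sum using (_⊎_)
open import Relation.Nullary using (yes; no)
open import Relation.Binary.PropositionalEquality using (_≡_)
open import Relation.Binary.Construct.Closure.Transitive using (TransClosure)

-- Convention: everything is 1-indexed on ℕ; [n] = {1,…,n}.
-- A function f : Fin n → Fin n (0-indexed) is read on [n] via  app f,
-- with app f m = 0 for m ∉ [n] (never used inside [n]).
app : {n : ℕ} → (Fin n → Fin n) → ℕ → ℕ
app f zero = zero
app {n} f (suc k) with k <? n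
... | yes k<n = suc (toℕ (f (fromℕ< k<n)))
... | no _ = zero

perm : {n : ℕ} → Permutation′ n → ℕ → ℕ
perm π = app (π ⟨$⟩ʳ_)

permInv : {n : ℕ} → Permutation′ n → ℕ → ℕ
permInv π = app (π ⟨$⟩ˡ_)

InRange : ℕ → ℕ → Set
InRange n i = 1 ≤ i × i ≤ n

Odd Even : ℕ → Set
Odd m = m % 2 ≡ 1
Even m = m % 2 ≡ 0

-- ε ∈ S_n: swaps 2i and 2i+1 for each i ≥ 1 with 2i+1 ≤ n; fixes the rest.
eps : ℕ → ℕ → ℕ
eps n m with m % 2
... | zero with 2 ≤? m | suc m ≤? n
...   | yes _ | yes _ = suc m
...   | _     | _     = m
eps n m | suc _ with 3 ≤? m
...   | yes _ = m ∸ 1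
...   | no _  = m

ZCover : ℕ → ℕ → ℕ → Set
ZCover n a b =
    (Odd a × 1 ≤ a × a + 1 ≤ n × b ≡ a + 1)
  ⊎ (Even b × 1 ≤ b × b + 1 ≤ n × a ≡ b + 1)

ZLt : ℕ → ℕ → ℕ → Set
ZLt n = TransClosure (ZCover n)

-- strict order of εZ_n: ε(i) < ε(j) iff i <_{Z_n} j
εZLt : ℕ → ℕ → ℕ → Set
εZLt n x y = Σ ℕ λ i → Σ ℕ λ j →
  InRange n i × InRange n j × eps n i ≡ x × eps n j ≡ y × ZLt n i j

IsLinExtεZ : (n : ℕ) → Permutation′ n → Set
IsLinExtεZ n π = ∀ i j → InRange n i → InRange n j →
  εZLt n i j → permInv π i < permInv π j

IsUpDown : (n : ℕ) → Permutation′ n → Set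
IsUpDown n u = ∀ i → 1 ≤ i → i + 1 ≤ n →
  (Odd i → perm u i < perm u (suc i)) × (Even i → perm u (suc i) < perm u i)

Des : (n : ℕ) → Permutation′ n → ℕ → Set
Des n π i = 1 ≤ i × i + 1 ≤ n × perm π (suc i) < perm π i

Ret₁ : (n : ℕ) → Permutation′ n → ℕ → Set
Ret₁ n u i = 1 ≤ i × i + 1 ≤ n × permInv u (suc i) + 1 < permInv u i

IsImage : (n : ℕ) → Permutation′ n → Permutation′ n → Set
IsImage n π u = ∀ i → InRange n i → perm u i ≡ permInv π (eps n i)

module Submission where

-- Writing u = π⁻¹ε, the condition that π is a linear extension of εZₙ says
-- exactly that u is strictly order-preserving on Zₙ, i.e. that u is up-down;
-- as ε is an involution, π = εu⁻¹ recovers π from u. For the descents,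
-- π(i) = ε(u⁻¹(i)), and ε displaces every point by at most one, reversing only
-- the pairs {2k, 2k+1}. Hence π(i+1) < π(i) iff u⁻¹(i+1) + 1 < u⁻¹(i), except in
-- two adjacent configurations of u⁻¹(i), u⁻¹(i+1) that the up-down pattern of
-- u forbids.

open import Defs
open import Data.Nat
  using (ℕ; zero; suc; _+_; _≤_; _<_; _%_; _<?_; _≤?_; z≤n; s≤s; s≤s⁻¹)
open import Data.Nat.Properties
open import Data.Nat.DivMod using (m%n<n; %-distribˡ-+)
open import Data.Fin using (Fin; toℕ; fromℕ<)
open import Data.Fin.Properties using (toℕ-fromℕ<; fromℕ<-toℕ; toℕ<n; toℕ-injective)
open import Data.Fin.Permutation
  using (Permutation′; permutation; _⟨$⟩ʳ_; _⟨$⟩ˡ_; inverseʳ; inverseˡ; flip; _∘ₚ_; _≈_)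
open import Data.Product using (Σ; ∃; _×_; _,_; proj₁; proj₂)
open import Data.Sum using (_⊎_; inj₁; inj₂)
open import Function.Bundles using (_⇔_; mk⇔; Equivalence)
open import Relation.Nullary using (¬_; yes; no; contradiction)
open import Relation.Binary.PropositionalEquality
  using (_≡_; _≢_; refl; sym; trans; cong; subst; subst₂; module ≡-Reasoning)
open import Relation.Binary.Construct.Closure.Transitive using ([_]; _∷_)

even⊎odd : ∀ m → Even m ⊎ Odd m
even⊎odd m with m % 2 | m%n<n m 2
... | zero        | _ = inj₁ refl
... | suc zero    | _ = inj₂ refl
... | suc (suc _) | s≤s (s≤s ())

even⇒odd-suc : ∀ {m} → Even m → Odd (suc m)
even⇒odd-suc {m} e = trans (%-distribˡ-+ 1 m 2) (cong (λ r → (1 + r) % 2) e)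

odd⇒even-suc : ∀ {m} → Odd m → Even (suc m)
odd⇒even-suc {m} o = trans (%-distribˡ-+ 1 m 2) (cong (λ r → (1 + r) % 2) o)

even⇒¬odd : ∀ {m} → Even m → ¬ Odd m
even⇒¬odd e o with trans (sym e) o
... | ()

odd-suc⇒even : ∀ {m} → Odd (suc m) → Even m
odd-suc⇒even {m} o with even⊎odd m
... | inj₁ e  = e
... | inj₂ o′ = contradiction o (even⇒¬odd {suc m} (odd⇒even-suc {m} o′))

even∧1≤⇒2≤ : ∀ {m} → Even m → 1 ≤ m → 2 ≤ m
even∧1≤⇒2≤ {suc zero}    () _
even∧1≤⇒2≤ {suc (suc _)} _  _ = s≤s (s≤s z≤n)

module _ {n : ℕ} where

  eps-even : ∀ {m} → Even m → 2 ≤ m → suc m ≤ n → eps n m ≡ suc m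
  eps-even {m} e 2≤m 1+m≤n with m % 2 | e
  ... | .0 | refl with 2 ≤? m | suc m ≤? n
  ...   | yes _   | yes _    = refl
  ...   | no 2≰m  | _        = contradiction 2≤m 2≰m
  ...   | yes _   | no 1+m≰n = contradiction 1+m≤n 1+m≰n

  eps-odd : ∀ {m} → Odd (suc m) → 2 ≤ m → eps n (suc m) ≡ m
  eps-odd {m} o 2≤m with suc m % 2 | o
  ... | .1 | refl with 3 ≤? suc m
  ...   | yes _   = refl
  ...   | no 3≰1+m = contradiction (s≤s 2≤m) 3≰1+m

  data EpsView : ℕ → ℕ → Set where
    raise : ∀ {m} → Even m → 2 ≤ m → suc m ≤ n → EpsView m (suc m)
    lower : ∀ {m} → Even m → 2 ≤ m → EpsView (suc m) m
    fixed : ∀ {m} → EpsView m m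

  epsView : ∀ m → EpsView m (eps n m)
  epsView m with m % 2 in p | m%n<n m 2
  ... | zero | _ with 2 ≤? m | suc m ≤? n
  ...   | yes 2≤m | yes 1+m≤n = raise p 2≤m 1+m≤n
  ...   | yes _   | no _      = fixed
  ...   | no _    | _         = fixed
  epsView m | suc zero | _ with 3 ≤? m
  ...   | yes (s≤s {n = k} 2≤k) = lower (odd-suc⇒even {k} p) 2≤k
  ...   | no _                 = fixed
  epsView m | suc (suc _) | s≤s (s≤s ())

  eps≤1+ : ∀ m → eps n m ≤ suc m
  eps≤1+ m with eps n m | epsView m
  ... | _ | raise _ _ _ = ≤-refl
  ... | _ | lower _ _   = ≤-trans (n≤1+n _) (n≤1+n _)
  ... | _ | fixed       = n≤1+n m

  ≤1+eps : ∀ m → m ≤ suc (eps n m)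
  ≤1+eps m with eps n m | epsView m
  ... | _ | raise _ _ _ = ≤-trans (n≤1+n m) (n≤1+n _)
  ... | _ | lower _ _   = ≤-refl
  ... | _ | fixed       = n≤1+n m

  odd⇒eps≤ : ∀ {m} → Odd m → eps n m ≤ m
  odd⇒eps≤ {m} o with eps n m | epsView m
  ... | _ | raise e _ _ = contradiction o (even⇒¬odd {m} e)
  ... | _ | lower _ _   = n≤1+n _
  ... | _ | fixed       = ≤-refl

  even⇒≤eps : ∀ {m} → Even m → m ≤ eps n m
  even⇒≤eps {m} e with eps n m | epsView m
  ... | _ | raise _ _ _ = n≤1+n m
  ... | _ | lower {k} e′ _ = contradiction (even⇒odd-suc {k} e′) (even⇒¬odd {m} e)
  ... | _ | fixed       = ≤-refl

  eps-inRange : ∀ {m} → InRange n m → InRange n (eps n m)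
  eps-inRange {m} (1≤m , m≤n) with eps n m | epsView m
  ... | _ | raise _ _ 1+m≤n = s≤s z≤n , 1+m≤n
  ... | _ | lower _ 2≤m     = ≤-trans (s≤s z≤n) 2≤m , ≤-trans (n≤1+n _) m≤n
  ... | _ | fixed           = 1≤m , m≤n

  eps-involutive : ∀ {m} → InRange n m → eps n (eps n m) ≡ m
  eps-involutive {m} (_ , m≤n) with eps n m in q | epsView m
  ... | _ | raise e 2≤m _ = eps-odd (even⇒odd-suc {m} e) 2≤m
  ... | _ | lower e 2≤m   = eps-even e 2≤m m≤n
  ... | _ | fixed         = q

  1+y<x⇒eps-y<eps-x : ∀ {x y} → suc y < x → eps n y < eps n x
  1+y<x⇒eps-y<eps-x {x} {y} 1+y<x with even⊎odd y
  ... | inj₂ odd-y = ≤-<-trans (odd⇒eps≤ odd-y) (s≤s⁻¹ (≤-trans 1+y<x (≤1+eps x)))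
  ... | inj₁ even-y = ≤-<-trans (eps≤1+ y) 2+y≤eps-x
    where
    2+y≤eps-x : suc (suc y) ≤ eps n x
    2+y≤eps-x with even⊎odd x | m≤n⇒m<n∨m≡n 1+y<x
    ... | inj₁ even-x | _          = ≤-trans 1+y<x (even⇒≤eps even-x)
    ... | inj₂ _      | inj₁ 2+y<x = s≤s⁻¹ (≤-trans 2+y<x (≤1+eps x))
    ... | inj₂ odd-x  | inj₂ refl  =
      contradiction odd-x (even⇒¬odd {x} (odd⇒even-suc {suc y} (even⇒odd-suc {y} even-y)))

  -- ε displaces points by at most one, so εy < εx and y + 1 < x can only disagree
  -- when |x − y| ≤ 1; the hypotheses exclude the cases where they do: x = y + 1
  -- with y odd (a pair ε keeps in order) and y = x + 1 with x even (a pair ε swaps).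
  eps-y<eps-x⇒1+y<x : ∀ {x y} → 1 ≤ y → x ≤ n → x ≢ y →
    (Odd y → x ≢ suc y) → (Even x → y ≢ suc x) →
    eps n y < eps n x → suc y < x
  eps-y<eps-x⇒1+y<x {x} {y} 1≤y x≤n x≢y ¬odd-y-below ¬even-x-below εy<εx with suc y <? x
  ... | yes 1+y<x = 1+y<x
  ... | no 1+y≮x  = contradiction εy<εx (≤⇒≯ (close⇒eps≤ (≮⇒≥ 1+y≮x)))
    where
    close⇒eps≤ : x ≤ suc y → eps n x ≤ eps n y
    close⇒eps≤ x≤1+y with m≤n⇒m<n∨m≡n x≤1+y
    close⇒eps≤ x≤1+y | inj₂ refl with even⊎odd y
    ... | inj₂ odd-y = contradiction refl (¬odd-y-below odd-y)
    ... | inj₁ even-y = begin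
      eps n (suc y) ≡⟨ eps-odd (even⇒odd-suc {y} even-y) 2≤y ⟩
      y             ≤⟨ n≤1+n y ⟩
      suc y         ≡⟨ eps-even even-y 2≤y x≤n ⟨
      eps n y       ∎
      where
      open ≤-Reasoning
      2≤y : 2 ≤ y
      2≤y = even∧1≤⇒2≤ even-y 1≤y
    close⇒eps≤ x≤1+y | inj₁ (s≤s x≤y) with m≤n⇒m<n∨m≡n (≤∧≢⇒< x≤y x≢y)
    ... | inj₁ 1+x<y = s≤s⁻¹ (≤-trans (s≤s (eps≤1+ x)) (≤-trans 1+x<y (≤1+eps y)))
    ... | inj₂ refl with even⊎odd x
    ...   | inj₁ even-x = contradiction refl (¬even-x-below even-x)
    ...   | inj₂ odd-x  =
      ≤-trans (odd⇒eps≤ odd-x) (≤-trans (n≤1+n x) (even⇒≤eps (odd⇒even-suc {x} odd-x)))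

toℕ₁ : ∀ {n} → Fin n → ℕ
toℕ₁ x = suc (toℕ x)

toℕ₁-inRange : ∀ {n} (x : Fin n) → InRange n (toℕ₁ x)
toℕ₁-inRange x = s≤s z≤n , toℕ<n x

toℕ₁-injective : ∀ {n} {x y : Fin n} → toℕ₁ x ≡ toℕ₁ y → x ≡ y
toℕ₁-injective p = toℕ-injective (suc-injective p)

inRange⇒toℕ₁ : ∀ {n i} → InRange n i → ∃ λ (x : Fin n) → toℕ₁ x ≡ i
inRange⇒toℕ₁ {i = suc k} (_ , 1+k≤n) = fromℕ< 1+k≤n , cong suc (toℕ-fromℕ< 1+k≤n)

app-toℕ₁ : ∀ {n} (f : Fin n → Fin n) x → app f (toℕ₁ x) ≡ toℕ₁ (f x)
app-toℕ₁ {n} f x with toℕ x <? n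
... | yes x<n = cong (λ y → toℕ₁ (f y)) (fromℕ<-toℕ x x<n)
... | no x≮n  = contradiction (toℕ<n x) x≮n

app-cong : ∀ {n} {f g : Fin n → Fin n} → (∀ x → f x ≡ g x) → ∀ i → app f i ≡ app g i
app-cong f≗g zero = refl
app-cong {n} f≗g (suc k) with k <? n
... | yes k<n = cong toℕ₁ (f≗g (fromℕ< k<n))
... | no _    = refl

module _ {n : ℕ} (π : Permutation′ n) where

  permInv-inRange : ∀ {i} → InRange n i → InRange n (permInv π i)
  permInv-inRange r with inRange⇒toℕ₁ r
  ... | x , refl rewrite app-toℕ₁ (π ⟨$⟩ˡ_) x = toℕ₁-inRange _

  perm-permInv : ∀ {i} → InRange n i → perm π (permInv π i) ≡ i
  perm-permInv r with inRange⇒toℕ₁ r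
  ... | x , refl rewrite app-toℕ₁ (π ⟨$⟩ˡ_) x | app-toℕ₁ (π ⟨$⟩ʳ_) (π ⟨$⟩ˡ x) =
    cong toℕ₁ (inverseʳ π)

epsᶠ : ∀ {n} → Fin n → Fin n
epsᶠ x = proj₁ (inRange⇒toℕ₁ (eps-inRange (toℕ₁-inRange x)))

epsᶠ-toℕ₁ : ∀ {n} (x : Fin n) → toℕ₁ (epsᶠ x) ≡ eps n (toℕ₁ x)
epsᶠ-toℕ₁ x = proj₂ (inRange⇒toℕ₁ (eps-inRange (toℕ₁-inRange x)))

epsᶠ-involutive : ∀ {n} (x : Fin n) → epsᶠ (epsᶠ x) ≡ x
epsᶠ-involutive {n} x = toℕ₁-injective (begin
  toℕ₁ (epsᶠ (epsᶠ x))   ≡⟨ epsᶠ-toℕ₁ (epsᶠ x) ⟩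
  eps n (toℕ₁ (epsᶠ x))  ≡⟨ cong (eps n) (epsᶠ-toℕ₁ x) ⟩
  eps n (eps n (toℕ₁ x)) ≡⟨ eps-involutive (toℕ₁-inRange x) ⟩
  toℕ₁ x                 ∎)
  where open ≡-Reasoning

ε : ∀ {n} → Permutation′ n
ε = permutation epsᶠ epsᶠ epsᶠ-involutive epsᶠ-involutive

module _ {n : ℕ} (π : Permutation′ n) where

  permInv-eps : ∀ x → permInv π (eps n (toℕ₁ x)) ≡ toℕ₁ ((ε ∘ₚ flip π) ⟨$⟩ʳ x)
  permInv-eps x = begin
    permInv π (eps n (toℕ₁ x))          ≡⟨ cong (permInv π) (epsᶠ-toℕ₁ x) ⟨
    permInv π (toℕ₁ (ε ⟨$⟩ʳ x))         ≡⟨ app-toℕ₁ (π ⟨$⟩ˡ_) (ε ⟨$⟩ʳ x) ⟩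
    toℕ₁ (π ⟨$⟩ˡ (ε ⟨$⟩ʳ x))            ∎
    where open ≡-Reasoning

  -- ∘ₚ composes in diagrammatic order, so ε ∘ₚ flip π is π⁻¹ε.
  isImage⇔≈ε∘ₚflip : ∀ u → IsImage n π u ⇔ u ≈ ε ∘ₚ flip π
  isImage⇔≈ε∘ₚflip u = mk⇔ to from
    where
    to : IsImage n π u → u ≈ ε ∘ₚ flip π
    to img x = toℕ₁-injective (begin
      toℕ₁ (u ⟨$⟩ʳ x)            ≡⟨ app-toℕ₁ (u ⟨$⟩ʳ_) x ⟨
      perm u (toℕ₁ x)            ≡⟨ img (toℕ₁ x) (toℕ₁-inRange x) ⟩
      permInv π (eps n (toℕ₁ x)) ≡⟨ permInv-eps x ⟩
      toℕ₁ ((ε ∘ₚ flip π) ⟨$⟩ʳ x) ∎)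
      where open ≡-Reasoning
    from : u ≈ ε ∘ₚ flip π → IsImage n π u
    from u≈ i r with inRange⇒toℕ₁ r
    ... | x , refl = begin
      perm u (toℕ₁ x)             ≡⟨ app-toℕ₁ (u ⟨$⟩ʳ_) x ⟩
      toℕ₁ (u ⟨$⟩ʳ x)             ≡⟨ cong toℕ₁ (u≈ x) ⟩
      toℕ₁ ((ε ∘ₚ flip π) ⟨$⟩ʳ x) ≡⟨ permInv-eps x ⟨
      permInv π (eps n (toℕ₁ x))  ∎
      where open ≡-Reasoning

module _ {n : ℕ} where

  open Equivalence

  isImage-ε∘ₚflip : ∀ (π : Permutation′ n) → IsImage n π (ε ∘ₚ flip π)
  isImage-ε∘ₚflip π = from (isImage⇔≈ε∘ₚflip π (ε ∘ₚ flip π)) (λ _ → refl)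

  isImage-flip∘ₚε : ∀ (u : Permutation′ n) → IsImage n (flip u ∘ₚ ε) u
  isImage-flip∘ₚε u =
    from (isImage⇔≈ε∘ₚflip (flip u ∘ₚ ε) u) (λ x → cong (u ⟨$⟩ʳ_) (sym (epsᶠ-involutive x)))

  isImage-injective : ∀ (π π′ u : Permutation′ n) →
    IsImage n π u → IsImage n π′ u → π ≈ π′
  isImage-injective π π′ u img img′ x = begin
    π ⟨$⟩ʳ x                       ≡⟨ inverseʳ π′ ⟨
    π′ ⟨$⟩ʳ (π′ ⟨$⟩ˡ (π ⟨$⟩ʳ x))   ≡⟨ cong (π′ ⟨$⟩ʳ_) (inverses-agree (π ⟨$⟩ʳ x)) ⟨
    π′ ⟨$⟩ʳ (π ⟨$⟩ˡ (π ⟨$⟩ʳ x))    ≡⟨ cong (π′ ⟨$⟩ʳ_) (inverseˡ π) ⟩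
    π′ ⟨$⟩ʳ x                      ∎
    where
    open ≡-Reasoning
    inverses-agree : ∀ y → π ⟨$⟩ˡ y ≡ π′ ⟨$⟩ˡ y
    inverses-agree y = begin
      π ⟨$⟩ˡ y                       ≡⟨ cong (π ⟨$⟩ˡ_) (epsᶠ-involutive y) ⟨
      π ⟨$⟩ˡ (ε ⟨$⟩ʳ (ε ⟨$⟩ʳ y))     ≡⟨ to (isImage⇔≈ε∘ₚflip π u) img (ε ⟨$⟩ʳ y) ⟨
      u ⟨$⟩ʳ (ε ⟨$⟩ʳ y)              ≡⟨ to (isImage⇔≈ε∘ₚflip π′ u) img′ (ε ⟨$⟩ʳ y) ⟩
      π′ ⟨$⟩ˡ (ε ⟨$⟩ʳ (ε ⟨$⟩ʳ y))    ≡⟨ cong (π′ ⟨$⟩ˡ_) (epsᶠ-involutive y) ⟩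
      π′ ⟨$⟩ˡ y                      ∎

ZMonotone : (n : ℕ) → Permutation′ n → Set
ZMonotone n u = ∀ {a b} → InRange n a → InRange n b → ZLt n a b → perm u a < perm u b

adjacent-inRange : ∀ {n i} → 1 ≤ i → i + 1 ≤ n → InRange n i × InRange n (suc i)
adjacent-inRange {n} {i} 1≤i i+1≤n =
  (1≤i , ≤-trans (n≤1+n i) 1+i≤n) , (s≤s z≤n , 1+i≤n)
  where
  1+i≤n = subst (_≤ n) (+-comm i 1) i+1≤n

module _ {n : ℕ} (u : Permutation′ n) where

  zMonotone⇒isUpDown : ZMonotone n u → IsUpDown n u
  zMonotone⇒isUpDown mono i 1≤i i+1≤n =
      (λ odd-i  → mono ri r1+i [ inj₁ (odd-i , 1≤i , i+1≤n , 1+i≡i+1) ])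
    , (λ even-i → mono r1+i ri [ inj₂ (even-i , 1≤i , i+1≤n , 1+i≡i+1) ])
    where
    ri = proj₁ (adjacent-inRange 1≤i i+1≤n)
    r1+i = proj₂ (adjacent-inRange 1≤i i+1≤n)
    1+i≡i+1 = +-comm 1 i

  isUpDown⇒zMonotone : IsUpDown n u → ZMonotone n u
  isUpDown⇒zMonotone updown _ _ = go
    where
    cover : ∀ {a b} → ZCover n a b → perm u a < perm u b
    cover {a} (inj₁ (odd-a , 1≤a , a+1≤n , refl)) =
      subst (λ c → perm u a < perm u c) (+-comm 1 a) (proj₁ (updown a 1≤a a+1≤n) odd-a)
    cover {b = b} (inj₂ (even-b , 1≤b , b+1≤n , refl)) =
      subst (λ c → perm u c < perm u b) (+-comm 1 b) (proj₂ (updown b 1≤b b+1≤n) even-b)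
    go : ∀ {a b} → ZLt n a b → perm u a < perm u b
    go [ a⋖b ]     = cover a⋖b
    go (a⋖b ∷ b<c) = <-trans (cover a⋖b) (go b<c)

  eps-y<eps-x⇔1+y<x : ∀ {x y} → IsUpDown n u → InRange n x → InRange n y →
    perm u y ≡ suc (perm u x) → (eps n y < eps n x ⇔ suc y < x)
  eps-y<eps-x⇔1+y<x {x} {y} updown (1≤x , x≤n) (1≤y , y≤n) uy≡1+ux =
    mk⇔ (eps-y<eps-x⇒1+y<x 1≤y x≤n x≢y ¬odd-y-below ¬even-x-below) 1+y<x⇒eps-y<eps-x
    where
    x≢y : x ≢ y
    x≢y refl = 1+n≢n (sym uy≡1+ux)
    ¬odd-y-below : Odd y → x ≢ suc y
    ¬odd-y-below odd-y refl =
      1+n≰n (<⇒≤ (subst (_< perm u x) uy≡1+ux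
        (proj₁ (updown y 1≤y (subst (_≤ n) (+-comm 1 y) x≤n)) odd-y)))
    ¬even-x-below : Even x → y ≢ suc x
    ¬even-x-below even-x refl =
      1+n≰n (<⇒≤ (subst (_< perm u x) uy≡1+ux
        (proj₂ (updown x 1≤x (subst (_≤ n) (+-comm 1 x) y≤n)) even-x)))

module _ {n : ℕ} (π u : Permutation′ n) where

  linExt⇒zMonotone : IsLinExtεZ n π → IsImage n π u → ZMonotone n u
  linExt⇒zMonotone lin img ra rb a<b =
    subst₂ _<_ (sym (img _ ra)) (sym (img _ rb))
      (lin _ _ (eps-inRange ra) (eps-inRange rb) (_ , _ , ra , rb , refl , refl , a<b))

  zMonotone⇒linExt : ZMonotone n u → IsImage n π u → IsLinExtεZ n π
  zMonotone⇒linExt mono img _ _ _ _ (a , b , ra , rb , refl , refl , a<b) =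
    subst₂ _<_ (img a ra) (img b rb) (mono ra rb a<b)

  linExt⇒isUpDown : IsLinExtεZ n π → IsImage n π u → IsUpDown n u
  linExt⇒isUpDown lin img = zMonotone⇒isUpDown u (linExt⇒zMonotone lin img)

  isUpDown⇒linExt : IsUpDown n u → IsImage n π u → IsLinExtεZ n π
  isUpDown⇒linExt updown = zMonotone⇒linExt (isUpDown⇒zMonotone u updown)

  perm≡eps∘permInv : ∀ {i} → IsImage n π u → InRange n i → perm π i ≡ eps n (permInv u i)
  perm≡eps∘permInv {i} img ri = begin
    perm π i                     ≡⟨ cong (perm π) (perm-permInv u ri) ⟨
    perm π (perm u x)            ≡⟨ cong (perm π) (img x rx) ⟩
    perm π (permInv π (eps n x)) ≡⟨ perm-permInv π (eps-inRange rx) ⟩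
    eps n x                      ∎
    where
    open ≡-Reasoning
    x = permInv u i
    rx = permInv-inRange u ri

  des⇔ret₁ : IsLinExtεZ n π → IsImage n π u → ∀ i → Des n π i ⇔ Ret₁ n u i
  des⇔ret₁ lin img i = mk⇔
    (λ (1≤i , i+1≤n , d) → 1≤i , i+1≤n , Equivalence.to (descent⇔retreat 1≤i i+1≤n) d)
    (λ (1≤i , i+1≤n , r) → 1≤i , i+1≤n , Equivalence.from (descent⇔retreat 1≤i i+1≤n) r)
    where
    descent⇔retreat : 1 ≤ i → i + 1 ≤ n →
      (perm π (suc i) < perm π i) ⇔ (permInv u (suc i) + 1 < permInv u i)
    descent⇔retreat 1≤i i+1≤n with adjacent-inRange 1≤i i+1≤n
    ... | ri , r1+i
      rewrite perm≡eps∘permInv img ri | perm≡eps∘permInv img r1+i | +-comm (permInv u (suc i)) 1 =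
      eps-y<eps-x⇔1+y<x u (linExt⇒isUpDown lin img)
        (permInv-inRange u ri) (permInv-inRange u r1+i)
        (trans (perm-permInv u r1+i) (cong suc (sym (perm-permInv u ri))))

proposition3p12 : (n : ℕ) → 1 ≤ n →
    ((π : Permutation′ n) → IsLinExtεZ n π →
      Σ (Permutation′ n) λ u → IsImage n π u × IsUpDown n u)
    × ((π π′ u : Permutation′ n) → IsLinExtεZ n π → IsLinExtεZ n π′ →
      IsImage n π u → IsImage n π′ u → ∀ i → InRange n i → perm π i ≡ perm π′ i)
    × ((u : Permutation′ n) → IsUpDown n u →
      Σ (Permutation′ n) λ π → IsLinExtεZ n π × IsImage n π u)
    × ((π u : Permutation′ n) → IsLinExtεZ n π → IsImage n π u →
      ∀ i → Des n π i ⇔ Ret₁ n u i)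
proposition3p12 n _ =
    (λ π lin → ε ∘ₚ flip π , isImage-ε∘ₚflip π ,
               linExt⇒isUpDown π (ε ∘ₚ flip π) lin (isImage-ε∘ₚflip π))
  , (λ π π′ u _ _ img img′ i _ → app-cong (isImage-injective π π′ u img img′) i)
  , (λ u updown → flip u ∘ₚ ε ,
                  isUpDown⇒linExt (flip u ∘ₚ ε) u updown (isImage-flip∘ₚε u) ,
                  isImage-flip∘ₚε u)
  , des⇔ret₁
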